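{- Let $\mathbb{F}$ be a field, $\omega:\coprod_{m=1}^{\infty} \mathbb{S}_m \to \mathbb{F}\setminus\{0\}$ any function, and $W \leq M_n(\mathbb{F})$ a linear subspace. Then $\rho_{\omega}(W) \geq \nu_b(\mathbb{B}(W))$.
   Context: $[n]=\{1,\dots,n\}$, $\mathbb{S}_m$ is the symmetric group on $[m]$. Let $\prec$ be the lexicographic order on $[n]^2$: $(i,j)\prec(i',j')$ iff $i<i'$, or $i=i'$ and $j<j'$. For $0\neq A\in M_n(\mathbb{F})$, $q(A)$ is the $\prec$-minimal $(i,j)$ with $A(i,j)\neq0$, and for $S\subset M_n(\mathbb{F})$, $\mathbb{B}(S)=\{q(A):0\ne A\in S\}$. A bipartite matching in $\mathcal{B}\subset[n]^2$ is a subset $\mathcal{B}_0\subset\mathcal{B}$ such that distinct pairs $(i,j)\neq(i',j')$ in $\mathcal{B}_0$ satisfy $i\ne i'$ and $j\ne j'$; $\nu_b(\mathcal{B})$ is the maximum size of one. For $A\in M_m(\mathbb{F})$, $D_\omega(A)=\sum_{\sigma\in\mathbb{S}_m}\omega(\sigma)\prod_{i=1}^m A(i,\sigma(i))$. For $I=\{i_1<\dots<i_k\}$, $J=\{j_1<\dots<j_k\}\subset[n]$, $A[I|J]$ is the $k\times k$ submatrix with $(\alpha,\beta)$ entry $A(i_\alpha,j_\beta)$. $\mathrm{rk}_\omega(A)$ is the largest $k$ such that $D_\omega(A[I|J])\neq0$ for some $k$-element $I,J$ (and $0$ if none), and $\rho_\omega(S)=\max\{\mathrm{rk}_\omega(A):A\in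 S\}$. -}

module Defs where

open import Level using (Level; _⊔_)
open import Data.Nat using (ℕ; zero; suc; _≤_; _<_)
import Data.Fin as Fin
open import Data.Fin using (Fin) renaming (_<_ to _<ᶠ_; _≟_ to _≟ᶠ_)
open import Data.Fin.Properties using () renaming (_≟_ to _≟F_)
open import Data.Product using (Σ; Σ-syntax; _×_; _,_)
open import Data.Sum using (_⊎_)
open import Data.List using (List; []; _∷_; concatMap; map; filter; foldr)
open import Data.Vec using (Vec; []; _∷_; lookup; toList)
open import Function using (_∘_)
open import Relation.Nullary using (¬_)
open import Relation.Binary.PropositionalEquality using (_≡_)
open import Algebra.Bundles using (CommutativeRing)
import Data.List
import Data.Product
import Data.List.Relation.Unary.Unique.DecPropositional as UniqueDec

record Field (c ℓ : Level) : Set (Level.suc (c ⊔ ℓ)) where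
  field
    commutativeRing : CommutativeRing c ℓ
  open CommutativeRing commutativeRing public
  field
    0≉1     : ¬ (0# ≈ 1#)
    inverse : ∀ x → ¬ (x ≈ 0#) → Σ[ y ∈ Carrier ] (x * y ≈ 1#)

-- Permutations of [m] = Fin m, represented as duplicate-free vectors
-- σ = (σ(1), …, σ(m)).  allPerms m enumerates all of 𝕊_m.

allVecs : (m k : ℕ) → List (Vec (Fin m) k)
allVecs m zero    = [] ∷ []
allVecs m (suc k) = concatMap (λ i → map (i ∷_) (allVecs m k)) (Data.List.allFin m)

IsPerm : {m : ℕ} → Vec (Fin m) m → Set
IsPerm {m} σ = UniqueDec.Unique (_≟F_ {m}) (toList σ)

allPerms : (m : ℕ) → List (Vec (Fin m) m)
allPerms m = filter (UniqueDec.unique? (_≟F_ {m}) ∘ toList) (allVecs m m)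

module _ {c ℓ : Level} (F : Field c ℓ) where
  open Field F

  Mat : ℕ → Set c
  Mat n = Fin n → Fin n → Carrier

  prodFin : (m : ℕ) → (Fin m → Carrier) → Carrier
  prodFin zero    f = 1#
  prodFin (suc m) f = f Fin.zero * prodFin m (f ∘ Fin.suc)

  sumList : List Carrier → Carrier
  sumList = foldr _+_ 0#

  -- ω : ∐_{m ≥ 1} 𝕊_m → F (values on non-permutation vectors and on m = 0 are never used)
  Weight : Set c
  Weight = (m : ℕ) → Vec (Fin m) m → Carrier

  NonvanishingWeight : Weight → Set ℓ
  NonvanishingWeight ω = ∀ m (σ : Vec (Fin m) m) → 1 ≤ m → IsPerm σ → ¬ (ω m σ ≈ 0#)

  D : Weight → (m : ℕ) → Mat m → Carrier
  D ω m A = sumList (map (λ σ → ω m σ * prodFin m (λ i → A i (lookup σ i))) (allPerms m))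

  -- k-element subsets of [n] as strictly increasing maps Fin k → Fin n
  Increasing : {k n : ℕ} → (Fin k → Fin n) → Set
  Increasing ι = ∀ a b → a <ᶠ b → ι a <ᶠ ι b

  sub : {n k : ℕ} → Mat n → (Fin k → Fin n) → (Fin k → Fin n) → Mat k
  sub A ι κ α β = A (ι α) (κ β)

  HasMinor : Weight → {n : ℕ} → Mat n → ℕ → Set ℓ
  HasMinor ω {n} A k =
    Σ[ ι ∈ (Fin k → Fin n) ] Σ[ κ ∈ (Fin k → Fin n) ]
      (Increasing ι × Increasing κ × ¬ (D ω k (sub A ι κ) ≈ 0#))

  IsRank : Weight → {n : ℕ} → Mat n → ℕ → Set ℓ
  IsRank ω {n} A r =
    (r ≡ 0 ⊎ (1 ≤ r × HasMinor ω A r)) ×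
    (∀ k → r < k → (ι κ : Fin k → Fin n) → Increasing ι → Increasing κ →
       D ω k (sub A ι κ) ≈ 0#)

  record IsSubspace {n : ℕ} (W : Mat n → Set (c ⊔ ℓ)) : Set (c ⊔ ℓ) where
    field
      respects : ∀ A B → (∀ i j → A i j ≈ B i j) → W A → W B
      zero∈    : W (λ i j → 0#)
      +-closed : ∀ A B → W A → W B → W (λ i j → A i j + B i j)
      ·-closed : ∀ a A → W A → W (λ i j → a * A i j)

  IsMaxRank : Weight → {n : ℕ} → (Mat n → Set (c ⊔ ℓ)) → ℕ → Set (c ⊔ ℓ)
  IsMaxRank ω W r =
    (Σ[ A ∈ _ ] (W A × IsRank ω A r)) ×
    (∀ A → W A → ∀ r′ → IsRank ω A r′ → r′ ≤ r)

  _≺_ : {n : ℕ} → Fin n × Fin n → Fin n × Fin n → Set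
  (i , j) ≺ (i′ , j′) = i <ᶠ i′ ⊎ (i ≡ i′ × j <ᶠ j′)

  IsQ : {n : ℕ} → Mat n → Fin n × Fin n → Set ℓ
  IsQ A (i , j) = ¬ (A i j ≈ 0#) × (∀ i′ j′ → (i′ , j′) ≺ (i , j) → A i′ j′ ≈ 0#)

  -- 𝔹(S) = { q(A) : 0 ≠ A ∈ S }  (IsQ A p already forces A ≠ 0)
  𝔹 : {n : ℕ} → (Mat n → Set (c ⊔ ℓ)) → Fin n × Fin n → Set (c ⊔ ℓ)
  𝔹 S p = Σ[ A ∈ _ ] (S A × IsQ A p)

IsMatching : {a : Level} {n : ℕ} → (Fin n × Fin n → Set a) → (m : ℕ) →
             (Fin m → Fin n × Fin n) → Set a
IsMatching 𝓑 m p =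
  (∀ x → 𝓑 (p x)) ×
  (∀ x y → ¬ (x ≡ y) → ¬ (Data.Product.proj₁ (p x) ≡ Data.Product.proj₁ (p y))
                     × ¬ (Data.Product.proj₂ (p x) ≡ Data.Product.proj₂ (p y)))

HasMatching : {a : Level} {n : ℕ} → (Fin n × Fin n → Set a) → ℕ → Set a
HasMatching {n = n} 𝓑 m = Σ[ p ∈ (Fin m → Fin n × Fin n) ] IsMatching 𝓑 m p

IsMaxMatching : {a : Level} {n : ℕ} → (Fin n × Fin n → Set a) → ℕ → Set a
IsMaxMatching 𝓑 m = HasMatching 𝓑 m × (∀ m′ → HasMatching 𝓑 m′ → m′ ≤ m)

-- Let A_1, …, A_m ∈ W have leading positions q(A_α) = (i_α, j_α) forming a matching, with
-- i_1 < … < i_m.  In the m × m block of rows i_α and columns {j_α}, the row taken from A_α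
-- vanishes left of column j_α, so only the "pivot" permutation contributes to D_ω and the
-- block is nonzero.  Now replace these rows, from the top, by the rows of one matrix B ∈ W:
-- D_ω is additive in each row, and adding A_t to B changes only row t of the block (A_t
-- vanishes on the rows above i_t), so either B or B + A_t keeps the block nonzero.  The
-- resulting B ∈ W has a nonzero ω-minor of size m, hence ρ_ω(W) ≥ rk_ω(B) ≥ m.
-- Equality in F is not decidable, so these case distinctions (and the existence of rk_ω(B))
-- are obtained under double negation; this suffices because m ≤ ρ_ω(W) is decidable.
module Submission where

open import Defs
open import Level using (Level; _⊔_)
open import Data.Nat using (ℕ; _≤_)

import Data.Nat as ℕ
open import Data.Nat using (zero; suc; _<_; z≤n; s≤s; _<?_; _≤?_)
import Data.Nat.Properties as ℕ
import Data.Fin as Fin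
open import Data.Fin using (Fin; zero; suc; toℕ; punchIn; punchOut)
  renaming (_<_ to _<ᶠ_; _≤_ to _≤ᶠ_)
open import Data.Fin.Properties
  using (_≟_; any?; injective⇒≤; punchOut-injective; punchIn-injective; punchInᵢ≢i;
         toℕ-injective; suc-injective; <-cmp; <⇒≢; toℕ-fromℕ<; toℕ<n)
  renaming (_<?_ to _<ᶠ?_; _≤?_ to _≤ᶠ?_)
open import Data.Fin.Permutation using (Permutation′; permutation; _⟨$⟩ʳ_; flip; inverseʳ)
open import Data.Product using (Σ-syntax; ∃; _×_; _,_; proj₁; proj₂)
open import Function using (_∘_; id)
open import Function.Bundles using (Injection)
open import Function.Properties.Inverse using (↔⇒↣)
open import Function.Definitions using (Injective)
open import Relation.Binary.Core using (_Preserves_⟶_)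
open import Relation.Binary.Definitions using (tri<; tri≈; tri>)
open import Relation.Binary.PropositionalEquality as ≡ using (_≡_; _≢_; _≗_)
open import Relation.Nullary using (¬_; yes; no; contradiction)
open import Relation.Nullary.Negation using (¬¬-map)
import Algebra.Properties.CommutativeMonoid.Sum as MonoidSum
open import Data.Vec using (Vec; []; _∷_; lookup; tabulate; toList)
import Data.Vec.Properties as Vec
open import Data.List using (List; []; _∷_; _++_; map; filter; concatMap)
import Data.List as List
import Data.List.Properties as List
open import Relation.Unary using (Pred; Decidable)
open import Data.Vec.Functional using (head; tail) renaming (_∷_ to _∷ᶠ_)
open import Data.Sum using (inj₁; inj₂)
open import Relation.Nullary.Decidable using (¬¬-excluded-middle; decidable-stable)
import Data.List.Relation.Unary.Unique.Propositional as ListUnique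
import Data.List.Relation.Unary.Unique.DecPropositional as UniqueDec
open import Data.List.Relation.Unary.AllPairs using ([]; _∷_)
open import Data.Vec.Relation.Unary.AllPairs using ([]; _∷_)
import Data.Vec.Relation.Unary.Unique.Propositional as VecUnique
import Data.Vec.Relation.Unary.Unique.Propositional.Properties as VecUniqueₚ
import Data.Vec.Relation.Unary.All.Properties as VecAll

private
  module ℕΣ = MonoidSum ℕ.+-0-commutativeMonoid

injective⇒surjective : ∀ {m} {f : Fin m → Fin m} → Injective _≡_ _≡_ f → ∀ y → ∃ λ x → f x ≡ y
injective⇒surjective {suc m} {f} f-inj y with any? (λ x → f x ≟ y)
... | yes hit  = hit
... | no  miss = contradiction (injective⇒≤ squeezed-injective) ℕ.1+n≰n
  where
  avoids : ∀ x → y ≢ f x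
  avoids x y≡fx = miss (x , ≡.sym y≡fx)
  squeezed : Fin (suc m) → Fin m
  squeezed x = punchOut (avoids x)
  squeezed-injective : Injective _≡_ _≡_ squeezed
  squeezed-injective {x} {x′} eq = f-inj (punchOut-injective (avoids x) (avoids x′) eq)

injective⇒permutation : ∀ {m} {f : Fin m → Fin m} → Injective _≡_ _≡_ f → Permutation′ m
injective⇒permutation {f = f} f-inj =
  permutation f (proj₁ ∘ surj) (proj₂ ∘ surj) (λ x → f-inj (proj₂ (surj (f x))))
  where surj = injective⇒surjective f-inj

sum-toℕ-injective : ∀ {m} {f : Fin m → Fin m} → Injective _≡_ _≡_ f → ℕΣ.sum (toℕ ∘ f) ≡ ℕΣ.sum (toℕ {m})
sum-toℕ-injective f-inj = ≡.sym (ℕΣ.sum-permute toℕ (injective⇒permutation f-inj))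

sum-mono-≤ : ∀ {m} (f g : Fin m → ℕ) → (∀ a → f a ≤ g a) → ℕΣ.sum f ≤ ℕΣ.sum g
sum-mono-≤ {zero}  f g f≤g = z≤n
sum-mono-≤ {suc m} f g f≤g = ℕ.+-mono-≤ (f≤g zero) (sum-mono-≤ (f ∘ suc) (g ∘ suc) (f≤g ∘ suc))

+-≤-≤-≡⇒≡ : ∀ {a b c d} → a ≤ c → b ≤ d → a ℕ.+ b ≡ c ℕ.+ d → a ≡ c × b ≡ d
+-≤-≤-≡⇒≡ {a} {b} {c} {d} a≤c b≤d eq = a≡c , ℕ.+-cancelˡ-≡ c b d (≡.subst (λ x → x ℕ.+ b ≡ c ℕ.+ d) a≡c eq)
  where
  a≡c : a ≡ c
  a≡c = ℕ.≤-antisym a≤c (ℕ.+-cancelʳ-≤ b c a (ℕ.≤-trans (ℕ.+-monoʳ-≤ c b≤d) (ℕ.≤-reflexive (≡.sym eq))))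

≤-sum-≡⇒≗ : ∀ {m} (f g : Fin m → ℕ) → (∀ a → f a ≤ g a) → ℕΣ.sum f ≡ ℕΣ.sum g → f ≗ g
≤-sum-≡⇒≗ {suc m} f g f≤g Σf≡Σg zero    = proj₁ (+-≤-≤-≡⇒≡ (f≤g zero) (sum-mono-≤ _ _ (f≤g ∘ suc)) Σf≡Σg)
≤-sum-≡⇒≗ {suc m} f g f≤g Σf≡Σg (suc a) =
  ≤-sum-≡⇒≗ (f ∘ suc) (g ∘ suc) (f≤g ∘ suc) (proj₂ (+-≤-≤-≡⇒≡ (f≤g zero) (sum-mono-≤ _ _ (f≤g ∘ suc)) Σf≡Σg)) a

-- Both maps are permutations of Fin m, so the sums of their values agree; a pointwise
-- inequality between sums that agree is an equality.
injective-≤⇒≗ : ∀ {m} {σ π : Fin m → Fin m} → Injective _≡_ _≡_ σ → Injective _≡_ _≡_ π →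
                (∀ a → π a ≤ᶠ σ a) → σ ≗ π
injective-≤⇒≗ {σ = σ} {π} σ-inj π-inj π≤σ a = ≡.sym (toℕ-injective
  (≤-sum-≡⇒≗ (toℕ ∘ π) (toℕ ∘ σ) π≤σ (≡.trans (sum-toℕ-injective π-inj) (≡.sym (sum-toℕ-injective σ-inj))) a))

argmin : ∀ {m n} (f : Fin (suc m) → Fin n) → ∃ λ a → ∀ b → f a ≤ᶠ f b
argmin {zero}  f = zero , λ { zero → ℕ.≤-refl }
argmin {suc m} f with argmin (f ∘ suc)
... | a , fa≤ with f zero ≤ᶠ? f (suc a)
...   | yes f0≤fa = zero  , λ { zero → ℕ.≤-refl ; (suc b) → ℕ.≤-trans f0≤fa (fa≤ b) }
...   | no  f0≰fa = suc a , λ { zero → ℕ.<⇒≤ (ℕ.≰⇒> f0≰fa) ; (suc b) → fa≤ b }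

sort : ∀ {m n} (f : Fin m → Fin n) → Injective _≡_ _≡_ f →
       Σ[ τ ∈ (Fin m → Fin m) ] Injective _≡_ _≡_ τ × (f ∘ τ) Preserves _<ᶠ_ ⟶ _<ᶠ_
sort {zero}  f f-inj = (λ ()) , (λ { {()} }) , (λ { {()} })
sort {suc m} f f-inj with argmin f
... | a , fa≤ with sort (f ∘ punchIn a) (λ eq → punchIn-injective a _ _ (f-inj eq))
...   | τ′ , τ′-inj , τ′-sorts = τ , τ-inj , τ-sorts
  where
  τ : Fin (suc m) → Fin (suc m)
  τ zero    = a
  τ (suc b) = punchIn a (τ′ b)
  τ-inj : Injective _≡_ _≡_ τ
  τ-inj {zero}  {zero}  _  = ≡.refl
  τ-inj {zero}  {suc y} eq = contradiction (≡.sym eq) (punchInᵢ≢i a (τ′ y))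
  τ-inj {suc x} {zero}  eq = contradiction eq (punchInᵢ≢i a (τ′ x))
  τ-inj {suc x} {suc y} eq = ≡.cong suc (τ′-inj (punchIn-injective a _ _ eq))
  τ-sorts : (f ∘ τ) Preserves _<ᶠ_ ⟶ _<ᶠ_
  τ-sorts {zero}  {suc b} _ = ℕ.≤∧≢⇒< (fa≤ _) (λ eq → punchInᵢ≢i a (τ′ b) (≡.sym (f-inj (toℕ-injective eq))))
  τ-sorts {suc x} {suc b} (s≤s x<b) = τ′-sorts x<b

distinct⇒injective : ∀ {a m} {A : Set a} (f : Fin m → A) → (∀ x y → x ≢ y → f x ≢ f y) → Injective _≡_ _≡_ f
distinct⇒injective f distinct {x} {y} fx≡fy = decidable-stable (x ≟ y) (λ x≢y → distinct x y x≢y fx≡fy)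

increasing⇒injective : ∀ {k n} {ι : Fin k → Fin n} → ι Preserves _<ᶠ_ ⟶ _<ᶠ_ → Injective _≡_ _≡_ ι
increasing⇒injective ι-inc {a} {b} eq with <-cmp a b
... | tri< a<b _ _ = contradiction eq (<⇒≢ (ι-inc a<b))
... | tri≈ _ a≡b _ = a≡b
... | tri> _ _ b<a = contradiction (≡.sym eq) (<⇒≢ (ι-inc b<a))

increasing⇒≤ : ∀ {k n} {ι : Fin k → Fin n} → ι Preserves _<ᶠ_ ⟶ _<ᶠ_ → k ≤ n
increasing⇒≤ = injective⇒≤ ∘ increasing⇒injective

unique-toList⁻ : ∀ {a n} {A : Set a} {xs : Vec A n} → ListUnique.Unique (toList xs) → VecUnique.Unique xs
unique-toList⁻ {xs = []}     []               = []
unique-toList⁻ {xs = x ∷ xs} (x∉xs ∷ xs-uniq) = VecAll.toList⁻ x∉xs ∷ unique-toList⁻ xs-uniq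

unique-toList⁺ : ∀ {a n} {A : Set a} {xs : Vec A n} → VecUnique.Unique xs → ListUnique.Unique (toList xs)
unique-toList⁺ []               = []
unique-toList⁺ (x∉xs ∷ xs-uniq) = VecAll.toList⁺ x∉xs ∷ unique-toList⁺ xs-uniq

IsPerm⇒lookup-injective : ∀ {m} {σ : Vec (Fin m) m} → IsPerm σ → Injective _≡_ _≡_ (lookup σ)
IsPerm⇒lookup-injective σ-perm = VecUniqueₚ.lookup-injective (unique-toList⁻ σ-perm) _ _

IsPerm? : ∀ m → Decidable (IsPerm {m})
IsPerm? m = UniqueDec.unique? (_≟_ {m}) ∘ toList

tabulate-IsPerm : ∀ {m} {f : Fin m → Fin m} → Injective _≡_ _≡_ f → IsPerm (tabulate f)
tabulate-IsPerm f-inj = unique-toList⁺ (VecUniqueₚ.tabulate⁺ f-inj)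

¬¬-∀-Fin : ∀ {p} n {P : Fin n → Set p} → (∀ x → ¬ ¬ P x) → ¬ ¬ (∀ x → P x)
¬¬-∀-Fin zero    ¬¬P ¬∀P = ¬∀P (λ ())
¬¬-∀-Fin (suc n) ¬¬P ¬∀P = ¬¬P zero λ P0 → ¬¬-∀-Fin n (¬¬P ∘ suc) λ Psuc →
  ¬∀P λ { zero → P0 ; (suc x) → Psuc x }

¬¬-∀-Fin→Fin : ∀ {p} k n {P : (Fin k → Fin n) → Set p} → (∀ {f g} → f ≗ g → P f → P g) →
               (∀ f → ¬ ¬ P f) → ¬ ¬ (∀ f → P f)
¬¬-∀-Fin→Fin zero    n P-resp ¬¬P ¬∀P = ¬¬P (λ ()) λ P! → ¬∀P λ f → P-resp (λ ()) P!
¬¬-∀-Fin→Fin (suc k) n P-resp ¬¬P ¬∀P =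
  ¬¬-∀-Fin n (λ a → ¬¬-∀-Fin→Fin k n (λ f≗g → P-resp (cons-cong f≗g)) (¬¬P ∘ (a ∷ᶠ_)))
    λ P∷ → ¬∀P λ f → P-resp (λ { zero → ≡.refl ; (suc i) → ≡.refl }) (P∷ (head f) (tail f))
  where
  cons-cong : ∀ {a} {f g : Fin k → Fin n} → f ≗ g → (a ∷ᶠ f) ≗ (a ∷ᶠ g)
  cons-cong f≗g zero    = ≡.refl
  cons-cong f≗g (suc i) = f≗g i

module _ {c ℓ : Level} (F : Field c ℓ) where
  open Field F hiding (zero)
  open import Relation.Binary.Reasoning.Setoid setoid
  open import Algebra.Properties.CommutativeSemigroup +-commutativeSemigroup using (interchange)

  *-≉0 : ∀ {x y} → ¬ x ≈ 0# → ¬ y ≈ 0# → ¬ x * y ≈ 0#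
  *-≉0 {x} {y} x≉0 y≉0 xy≈0 with inverse x x≉0
  ... | x⁻¹ , xx⁻¹≈1 = y≉0 (begin
    y              ≈⟨ *-identityˡ y ⟨
    1# * y         ≈⟨ *-congʳ (trans (sym xx⁻¹≈1) (*-comm x x⁻¹)) ⟩
    (x⁻¹ * x) * y  ≈⟨ *-assoc x⁻¹ x y ⟩
    x⁻¹ * (x * y)  ≈⟨ *-congˡ xy≈0 ⟩
    x⁻¹ * 0#       ≈⟨ zeroʳ x⁻¹ ⟩
    0#             ∎)

  prodFin-cong : ∀ m {f g : Fin m → Carrier} → (∀ i → f i ≈ g i) → prodFin F m f ≈ prodFin F m g
  prodFin-cong zero    f≈g = refl
  prodFin-cong (suc m) f≈g = *-cong (f≈g zero) (prodFin-cong m (f≈g ∘ suc))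

  prodFin-≈0 : ∀ m (f : Fin m → Carrier) i → f i ≈ 0# → prodFin F m f ≈ 0#
  prodFin-≈0 (suc m) f zero    fi≈0 = trans (*-congʳ fi≈0) (zeroˡ _)
  prodFin-≈0 (suc m) f (suc i) fi≈0 = trans (*-congˡ (prodFin-≈0 m (f ∘ suc) i fi≈0)) (zeroʳ _)

  prodFin-≉0 : ∀ m (f : Fin m → Carrier) → (∀ i → ¬ f i ≈ 0#) → ¬ prodFin F m f ≈ 0#
  prodFin-≉0 zero    f f≉0 1≈0 = 0≉1 (sym 1≈0)
  prodFin-≉0 (suc m) f f≉0     = *-≉0 (f≉0 zero) (prodFin-≉0 m (f ∘ suc) (f≉0 ∘ suc))

  prodFin-additive : ∀ m (f g h : Fin m → Carrier) t →
                     (∀ i → i ≢ t → f i ≈ g i × f i ≈ h i) → f t ≈ g t + h t →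
                     prodFin F m f ≈ prodFin F m g + prodFin F m h
  prodFin-additive (suc m) f g h zero f≈ ft≈ = begin
    f zero * prodFin F m (f ∘ suc)
      ≈⟨ *-cong ft≈ (prodFin-cong m (λ i → proj₁ (f≈ (suc i) λ ()))) ⟩
    (g zero + h zero) * prodFin F m (g ∘ suc)
      ≈⟨ distribʳ _ _ _ ⟩
    g zero * prodFin F m (g ∘ suc) + h zero * prodFin F m (g ∘ suc)
      ≈⟨ +-congˡ (*-congˡ (prodFin-cong m (λ i → trans (sym (proj₁ (f≈ (suc i) λ ()))) (proj₂ (f≈ (suc i) λ ()))))) ⟩
    g zero * prodFin F m (g ∘ suc) + h zero * prodFin F m (h ∘ suc) ∎
  prodFin-additive (suc m) f g h (suc t) f≈ ft≈ = begin
    f zero * prodFin F m (f ∘ suc)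
      ≈⟨ *-congˡ (prodFin-additive m (f ∘ suc) (g ∘ suc) (h ∘ suc) t (λ i i≢t → f≈ (suc i) (i≢t ∘ suc-injective)) ft≈) ⟩
    f zero * (prodFin F m (g ∘ suc) + prodFin F m (h ∘ suc))
      ≈⟨ distribˡ _ _ _ ⟩
    f zero * prodFin F m (g ∘ suc) + f zero * prodFin F m (h ∘ suc)
      ≈⟨ +-cong (*-congʳ (proj₁ (f≈ zero λ ()))) (*-congʳ (proj₂ (f≈ zero λ ()))) ⟩
    g zero * prodFin F m (g ∘ suc) + h zero * prodFin F m (h ∘ suc) ∎

  module _ {a} {A : Set a} where

    sumList-map-cong : ∀ {f g : A → Carrier} xs → (∀ x → f x ≈ g x) → sumList F (map f xs) ≈ sumList F (map g xs)
    sumList-map-cong []       f≈g = refl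
    sumList-map-cong (x ∷ xs) f≈g = +-cong (f≈g x) (sumList-map-cong xs f≈g)

    sumList-map-+ : ∀ (f g : A → Carrier) xs →
                    sumList F (map (λ x → f x + g x) xs) ≈ sumList F (map f xs) + sumList F (map g xs)
    sumList-map-+ f g []       = sym (+-identityˡ 0#)
    sumList-map-+ f g (x ∷ xs) = trans (+-congˡ (sumList-map-+ f g xs)) (interchange _ _ _ _)

    sumList-map-≈0 : ∀ (f : A → Carrier) xs → (∀ x → f x ≈ 0#) → sumList F (map f xs) ≈ 0#
    sumList-map-≈0 f []       f≈0 = refl
    sumList-map-≈0 f (x ∷ xs) f≈0 = trans (+-cong (f≈0 x) (sumList-map-≈0 f xs f≈0)) (+-identityˡ 0#)

    sumList-filter : ∀ {p} {P : Pred A p} (P? : Decidable P) (f g : A → Carrier) xs →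
                     (∀ x → P x → g x ≈ f x) → (∀ x → ¬ P x → g x ≈ 0#) →
                     sumList F (map f (filter P? xs)) ≈ sumList F (map g xs)
    sumList-filter P? f g []       g≈f g≈0 = refl
    sumList-filter P? f g (x ∷ xs) g≈f g≈0 with P? x
    ... | yes Px = +-cong (sym (g≈f x Px)) (sumList-filter P? f g xs g≈f g≈0)
    ... | no ¬Px = trans (sym (+-identityˡ _))
                         (+-cong (sym (g≈0 x ¬Px)) (sumList-filter P? f g xs g≈f g≈0))

  sumList-++ : ∀ xs ys → sumList F (xs ++ ys) ≈ sumList F xs + sumList F ys
  sumList-++ []       ys = sym (+-identityˡ _)
  sumList-++ (x ∷ xs) ys = trans (+-congˡ (sumList-++ xs ys)) (sym (+-assoc _ _ _))

  sumList-concatMap : ∀ {a b} {A : Set a} {B : Set b} (g : B → Carrier) (f : A → List B) xs →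
                      sumList F (map g (concatMap f xs)) ≈ sumList F (map (λ x → sumList F (map g (f x))) xs)
  sumList-concatMap g f []       = refl
  sumList-concatMap g f (x ∷ xs) = begin
    sumList F (map g (f x ++ concatMap f xs))
      ≡⟨ ≡.cong (sumList F) (List.map-++ g (f x) (concatMap f xs)) ⟩
    sumList F (map g (f x) ++ map g (concatMap f xs))
      ≈⟨ sumList-++ (map g (f x)) (map g (concatMap f xs)) ⟩
    sumList F (map g (f x)) + sumList F (map g (concatMap f xs))
      ≈⟨ +-congˡ (sumList-concatMap g f xs) ⟩
    sumList F (map g (f x)) + sumList F (map (λ x → sumList F (map g (f x))) xs) ∎

  sumList-tabulate-≈0 : ∀ {n} (h : Fin n → Carrier) → (∀ j → h j ≈ 0#) → sumList F (List.tabulate h) ≈ 0#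
  sumList-tabulate-≈0 {zero}  h h≈0 = refl
  sumList-tabulate-≈0 {suc n} h h≈0 =
    trans (+-cong (h≈0 zero) (sumList-tabulate-≈0 (h ∘ suc) (h≈0 ∘ suc))) (+-identityˡ 0#)

  sumList-tabulate-single : ∀ {n} (h : Fin n → Carrier) i → (∀ j → j ≢ i → h j ≈ 0#) →
                            sumList F (List.tabulate h) ≈ h i
  sumList-tabulate-single h zero    h≈0 =
    trans (+-congˡ (sumList-tabulate-≈0 (h ∘ suc) (λ j → h≈0 (suc j) λ ()))) (+-identityʳ _)
  sumList-tabulate-single h (suc i) h≈0 =
    trans (+-cong (h≈0 zero λ ()) (sumList-tabulate-single (h ∘ suc) i (λ j j≢i → h≈0 (suc j) (j≢i ∘ suc-injective))))
          (+-identityˡ _)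

  sumList-allVecs-single : ∀ m k (g : Vec (Fin m) k → Carrier) v → (∀ w → w ≢ v → g w ≈ 0#) →
                           sumList F (map g (allVecs m k)) ≈ g v
  sumList-allVecs-single m zero    g []      g≈0 = +-identityʳ _
  sumList-allVecs-single m (suc k) g (x ∷ v) g≈0 = begin
    sumList F (map g (concatMap extend (List.allFin m)))
      ≈⟨ sumList-concatMap g extend (List.allFin m) ⟩
    sumList F (map (λ i → sumList F (map g (extend i))) (List.allFin m))
      ≡⟨ ≡.cong (sumList F) (List.map-tabulate {n = m} id (λ i → sumList F (map g (extend i)))) ⟩
    sumList F (List.tabulate (λ i → sumList F (map g (extend i))))
      ≈⟨ sumList-tabulate-single _ x other-heads≈0 ⟩
    sumList F (map g (extend x))
      ≡⟨ ≡.cong (sumList F) (≡.sym (List.map-∘ (allVecs m k))) ⟩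
    sumList F (map (g ∘ (x ∷_)) (allVecs m k))
      ≈⟨ sumList-allVecs-single m k (g ∘ (x ∷_)) v (λ w w≢v → g≈0 (x ∷ w) (w≢v ∘ Vec.∷-injectiveʳ)) ⟩
    g (x ∷ v) ∎
    where
    extend : Fin m → List (Vec (Fin m) (suc k))
    extend i = map (i ∷_) (allVecs m k)
    other-heads≈0 : ∀ i → i ≢ x → sumList F (map g (extend i)) ≈ 0#
    other-heads≈0 i i≢x = trans (reflexive (≡.cong (sumList F) (≡.sym (List.map-∘ (allVecs m k)))))
      (sumList-map-≈0 (g ∘ (i ∷_)) (allVecs m k) (λ w → g≈0 (i ∷ w) (i≢x ∘ Vec.∷-injectiveˡ)))

  module _ (ω : Weight F) where

    permTerm : ∀ {k} → Mat F k → Vec (Fin k) k → Carrier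
    permTerm {k} M σ = ω k σ * prodFin F k (λ i → M i (lookup σ i))

    D-cong : ∀ k {M M′ : Mat F k} → (∀ i j → M i j ≈ M′ i j) → D F ω k M ≈ D F ω k M′
    D-cong k M≈M′ = sumList-map-cong (allPerms k) (λ σ → *-congˡ (prodFin-cong k (λ i → M≈M′ i _)))

    D-row-additive : ∀ k (M M₁ M₂ : Mat F k) t →
                     (∀ i j → i ≢ t → M i j ≈ M₁ i j × M i j ≈ M₂ i j) →
                     (∀ j → M t j ≈ M₁ t j + M₂ t j) →
                     D F ω k M ≈ D F ω k M₁ + D F ω k M₂
    D-row-additive k M M₁ M₂ t M≈ Mt≈ = begin
      D F ω k M
        ≈⟨ sumList-map-cong (allPerms k) term-additive ⟩
      sumList F (map (λ σ → permTerm M₁ σ + permTerm M₂ σ) (allPerms k))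
        ≈⟨ sumList-map-+ (permTerm M₁) (permTerm M₂) (allPerms k) ⟩
      D F ω k M₁ + D F ω k M₂ ∎
      where
      term-additive : ∀ σ → permTerm M σ ≈ permTerm M₁ σ + permTerm M₂ σ
      term-additive σ = trans
        (*-congˡ (prodFin-additive k _ _ _ t (λ i i≢t → M≈ i (lookup σ i) i≢t) (Mt≈ (lookup σ t))))
        (distribˡ _ _ _)

    D-single-term : ∀ k (M : Mat F k) π → IsPerm π →
                    (∀ σ → IsPerm σ → σ ≢ π → permTerm M σ ≈ 0#) → D F ω k M ≈ permTerm M π
    D-single-term k M π π-perm others≈0 = begin
      D F ω k M
        ≈⟨ sumList-filter (IsPerm? k) (permTerm M) permTermIfPerm (allVecs k k) (λ σ → ifPerm-yes σ) ifPerm-no ⟩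
      sumList F (map permTermIfPerm (allVecs k k))
        ≈⟨ sumList-allVecs-single k k permTermIfPerm π single ⟩
      permTermIfPerm π
        ≈⟨ ifPerm-yes π π-perm ⟩
      permTerm M π ∎
      where
      permTermIfPerm : Vec (Fin k) k → Carrier
      permTermIfPerm σ with IsPerm? k σ
      ... | yes _ = permTerm M σ
      ... | no  _ = 0#
      ifPerm-yes : ∀ σ → IsPerm σ → permTermIfPerm σ ≈ permTerm M σ
      ifPerm-yes σ σ-perm with IsPerm? k σ
      ... | yes _      = refl
      ... | no  ¬perm  = contradiction σ-perm ¬perm
      ifPerm-no : ∀ σ → ¬ IsPerm σ → permTermIfPerm σ ≈ 0#
      ifPerm-no σ ¬perm with IsPerm? k σ
      ... | yes σ-perm = contradiction σ-perm ¬perm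
      ... | no  _      = refl
      single : ∀ σ → σ ≢ π → permTermIfPerm σ ≈ 0#
      single σ σ≢π with IsPerm? k σ
      ... | yes σ-perm = others≈0 σ σ-perm σ≢π
      ... | no  _      = refl

    -- Any other permutation σ has σ α < π α somewhere (else σ = π by injective-≤⇒≗),
    -- so its term picks up a zero entry; the term of π itself is a product of nonzeros.
    D-pivots-≉0 : NonvanishingWeight F ω → ∀ k (M : Mat F (suc k)) (π : Permutation′ (suc k)) →
                  (∀ α β → β <ᶠ π ⟨$⟩ʳ α → M α β ≈ 0#) → (∀ α → ¬ M α (π ⟨$⟩ʳ α) ≈ 0#) →
                  ¬ D F ω (suc k) M ≈ 0#
    D-pivots-≉0 ω≉0 k M π left≈0 pivot≉0 D≈0 =
      *-≉0 (ω≉0 (suc k) πv (s≤s z≤n) πv-perm) (prodFin-≉0 (suc k) _ πv-entries≉0)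
        (trans (sym (D-single-term (suc k) M πv πv-perm others≈0)) D≈0)
      where
      πv : Vec (Fin (suc k)) (suc k)
      πv = tabulate (π ⟨$⟩ʳ_)
      π-injective : Injective _≡_ _≡_ (π ⟨$⟩ʳ_)
      π-injective = Injection.injective (↔⇒↣ π)
      πv-perm : IsPerm πv
      πv-perm = tabulate-IsPerm π-injective
      πv-entries≉0 : ∀ α → ¬ M α (lookup πv α) ≈ 0#
      πv-entries≉0 α rewrite Vec.lookup∘tabulate (π ⟨$⟩ʳ_) α = pivot≉0 α
      others≈0 : ∀ σ → IsPerm σ → σ ≢ πv → permTerm M σ ≈ 0#
      others≈0 σ σ-perm σ≢πv with any? (λ α → lookup σ α <ᶠ? π ⟨$⟩ʳ α)
      ... | yes (α , σα<πα) = trans (*-congˡ (prodFin-≈0 (suc k) (λ i → M i (lookup σ i)) α (left≈0 α _ σα<πα))) (zeroʳ _)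
      ... | no  ¬σ<π        = contradiction σ≡πv σ≢πv
        where
        σ≡πv : σ ≡ πv
        σ≡πv = ≡.trans (≡.sym (Vec.tabulate∘lookup σ)) (Vec.tabulate-cong
          (injective-≤⇒≗ (IsPerm⇒lookup-injective σ-perm) π-injective (λ α → ℕ.≮⇒≥ (λ lt → ¬σ<π (α , lt)))))

  Increasing-resp : ∀ {k n} {ι ι′ : Fin k → Fin n} → ι ≗ ι′ → Increasing F ι → Increasing F ι′
  Increasing-resp ι≗ι′ ι-inc a b a<b = ≡.subst₂ _<ᶠ_ (ι≗ι′ a) (ι≗ι′ b) (ι-inc a b a<b)

  module _ (ω : Weight F) {n : ℕ} (B : Mat F n) where

    MinorVanishes : ∀ {k} (ι κ : Fin k → Fin n) → Set ℓ
    MinorVanishes {k} ι κ = Increasing F ι → Increasing F κ → D F ω k (sub F B ι κ) ≈ 0#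

    MinorVanishes-resp : ∀ {k} {ι ι′ κ κ′ : Fin k → Fin n} → ι ≗ ι′ → κ ≗ κ′ →
                         MinorVanishes ι κ → MinorVanishes ι′ κ′
    MinorVanishes-resp {k} ι≗ κ≗ vanish ι′-inc κ′-inc =
      trans (D-cong ω k (λ a b → reflexive (≡.cong₂ B (≡.sym (ι≗ a)) (≡.sym (κ≗ b)))))
            (vanish (Increasing-resp (≡.sym ∘ ι≗) ι′-inc) (Increasing-resp (≡.sym ∘ κ≗) κ′-inc))

    MinorsVanish : ℕ → Set ℓ
    MinorsVanish k = ∀ (ι κ : Fin k → Fin n) → MinorVanishes ι κ

    minor⇒≤rank : ∀ {r k} → IsRank F ω B r → HasMinor F ω B k → k ≤ r
    minor⇒≤rank {k = k} (_ , vanish) (ι , κ , ι-inc , κ-inc , D≉0) =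
      ℕ.≮⇒≥ (λ r<k → D≉0 (vanish k r<k ι κ ι-inc κ-inc))

    ¬minor⇒¬¬MinorsVanish : ∀ k → ¬ HasMinor F ω B k → ¬ ¬ MinorsVanish k
    ¬minor⇒¬¬MinorsVanish k ¬minor =
      ¬¬-∀-Fin→Fin k n (λ ι≗ vanish κ → MinorVanishes-resp ι≗ (λ _ → ≡.refl) (vanish κ))
        (λ ι → ¬¬-∀-Fin→Fin k n (MinorVanishes-resp (λ _ → ≡.refl)) (λ κ → ¬¬-vanishes ι κ))
      where
      ¬¬-vanishes : ∀ ι κ → ¬ ¬ MinorVanishes ι κ
      ¬¬-vanishes ι κ ¬vanish = ¬vanish λ ι-inc κ-inc →
        contradiction (ι , κ , ι-inc , κ-inc , λ D≈0 → ¬vanish (λ _ _ → D≈0)) ¬minor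

    -- Downward search from n: no increasing ι : Fin k → Fin n exists for k > n.
    ¬¬-rank : ¬ ¬ ∃ (IsRank F ω B)
    ¬¬-rank = search n (λ k n<k ι κ ι-inc _ → contradiction (increasing⇒≤ (λ {a} {b} → ι-inc a b)) (ℕ.<⇒≱ n<k))
      where
      search : ∀ s → (∀ k → s < k → MinorsVanish k) → ¬ ¬ ∃ (IsRank F ω B)
      search zero    vanish ¬rank = ¬rank (0 , inj₁ ≡.refl , vanish)
      search (suc s) vanish ¬rank = ¬¬-excluded-middle λ
        { (yes minor) → ¬rank (suc s , inj₂ (s≤s z≤n , minor) , vanish)
        ; (no ¬minor) → ¬minor⇒¬¬MinorsVanish (suc s) ¬minor λ vanishₛ →
            search s (vanish-above vanishₛ) ¬rank }
        where
        vanish-above : MinorsVanish (suc s) → ∀ k → s < k → MinorsVanish k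
        vanish-above vanishₛ k s<k with ℕ.m≤n⇒m<n∨m≡n s<k
        ... | inj₁ s+1<k  = vanish k s+1<k
        ... | inj₂ ≡.refl = vanishₛ

  -- Matrices of W whose leading positions q(A α) = (row α , col (pivot α)) form a matching,
  -- listed by increasing row; col lists the matched columns in increasing order.
  record Staircase {n} (W : Mat F n → Set (c ⊔ ℓ)) (m : ℕ) : Set (c ⊔ ℓ) where
    field
      row col        : Fin m → Fin n
      row-increasing : Increasing F row
      col-increasing : Increasing F col
      pivot          : Permutation′ m
      matrix         : Fin m → Mat F n
      matrix∈W       : ∀ α → W (matrix α)
      leading        : ∀ α → IsQ F (matrix α) (row α , col (pivot ⟨$⟩ʳ α))

  module StaircaseMinor {n} {W : Mat F n → Set (c ⊔ ℓ)} (W-sub : IsSubspace F W)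
                        (ω : Weight F) (ω≉0 : NonvanishingWeight F ω)
                        {k} (S : Staircase W (suc k)) where
    open Staircase S
    open IsSubspace W-sub

    private
      m : ℕ
      m = suc k

    above-leading-row≈0 : ∀ {α t} → α <ᶠ t → ∀ j → matrix t (row α) j ≈ 0#
    above-leading-row≈0 {α} {t} α<t j = proj₂ (leading t) (row α) j (inj₁ (row-increasing α t α<t))

    left-of-leading≈0 : ∀ α β → β <ᶠ pivot ⟨$⟩ʳ α → matrix α (row α) (col β) ≈ 0#
    left-of-leading≈0 α β β<π = proj₂ (leading α) (row α) (col β) (inj₂ (≡.refl , col-increasing β _ β<π))

    mixed : ℕ → Mat F n → Mat F m
    mixed s B α β with toℕ α <? s
    ... | yes _ = B (row α) (col β)
    ... | no  _ = matrix α (row α) (col β)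

    mixed-below : ∀ {s} B α β → toℕ α < s → mixed s B α β ≡ B (row α) (col β)
    mixed-below {s} B α β α<s with toℕ α <? s
    ... | yes _   = ≡.refl
    ... | no  α≮s = contradiction α<s α≮s

    mixed-above : ∀ {s} B α β → s ≤ toℕ α → mixed s B α β ≡ matrix α (row α) (col β)
    mixed-above {s} B α β s≤α with toℕ α <? s
    ... | yes α<s = contradiction α<s (ℕ.≤⇒≯ s≤α)
    ... | no  _   = ≡.refl

    D-mixed-zero≉0 : ∀ B → ¬ D F ω m (mixed 0 B) ≈ 0#
    D-mixed-zero≉0 B D≈0 = D-pivots-≉0 ω ω≉0 k (λ α β → matrix α (row α) (col β)) pivot
      left-of-leading≈0 (proj₁ ∘ leading)
      (trans (D-cong ω m (λ α β → reflexive (≡.sym (mixed-above B α β z≤n)))) D≈0)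

    -- Adding matrix t to B only changes row t of the minor, by the row of matrix t itself:
    -- the rows above are zero in matrix t, the rows below do not come from B.
    module _ {s} (s<m : s < m) (B : Mat F n) where

      t : Fin m
      t = Fin.fromℕ< s<m

      toℕ-t : toℕ t ≡ s
      toℕ-t = toℕ-fromℕ< s<m

      B⁺ : Mat F n
      B⁺ i j = B i j + matrix t i j

      D-mixed-step : D F ω m (mixed (suc s) B⁺) ≈ D F ω m (mixed (suc s) B) + D F ω m (mixed s B)
      D-mixed-step = D-row-additive ω m _ _ _ t off-row on-row
        where
        off-row : ∀ α β → α ≢ t → mixed (suc s) B⁺ α β ≈ mixed (suc s) B α β
                                × mixed (suc s) B⁺ α β ≈ mixed s B α β
        off-row α β α≢t with ℕ.<-cmp (toℕ α) s
        ... | tri< α<s _ _ = below (mixed-below B α β (ℕ.m<n⇒m<1+n α<s)) , below (mixed-below B α β α<s)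
          where
          below : ∀ {x} → x ≡ B (row α) (col β) → mixed (suc s) B⁺ α β ≈ x
          below ≡B = begin
            mixed (suc s) B⁺ α β
              ≡⟨ mixed-below B⁺ α β (ℕ.m<n⇒m<1+n α<s) ⟩
            B (row α) (col β) + matrix t (row α) (col β)
              ≈⟨ +-congˡ (above-leading-row≈0 (≡.subst (toℕ α <_) (≡.sym toℕ-t) α<s) (col β)) ⟩
            B (row α) (col β) + 0#
              ≈⟨ +-identityʳ _ ⟩
            B (row α) (col β)
              ≡⟨ ≡.sym ≡B ⟩
            _ ∎
        ... | tri≈ _ α≡s _ = contradiction (toℕ-injective (≡.trans α≡s (≡.sym toℕ-t))) α≢t
        ... | tri> _ _ s<α = reflexive (≡.trans (mixed-above B⁺ α β s<α) (≡.sym (mixed-above B α β s<α)))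
                           , reflexive (≡.trans (mixed-above B⁺ α β s<α) (≡.sym (mixed-above B α β (ℕ.<⇒≤ s<α))))
        t<s+1 : toℕ t < suc s
        t<s+1 = s≤s (ℕ.≤-reflexive toℕ-t)
        on-row : ∀ β → mixed (suc s) B⁺ t β ≈ mixed (suc s) B t β + mixed s B t β
        on-row β = reflexive (≡.trans (mixed-below B⁺ t β t<s+1) (≡.cong₂ _+_
          (≡.sym (mixed-below B t β t<s+1)) (≡.sym (mixed-above B t β (ℕ.≤-reflexive (≡.sym toℕ-t))))))

    ¬¬-mixed≉0 : ∀ s → s ≤ m → ¬ ¬ (Σ[ B ∈ Mat F n ] W B × ¬ D F ω m (mixed s B) ≈ 0#)
    ¬¬-mixed≉0 zero    _   ¬ok = ¬ok ((λ _ _ → 0#) , zero∈ , D-mixed-zero≉0 (λ _ _ → 0#))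
    ¬¬-mixed≉0 (suc s) s<m ¬ok = ¬¬-mixed≉0 s (ℕ.<⇒≤ s<m) λ { (B , B∈W , Dₛ≉0) →
      ¬¬-excluded-middle λ
        { (no Dₛ₊₁≉0) → ¬ok (B , B∈W , Dₛ₊₁≉0)
        ; (yes Dₛ₊₁≈0) → ¬ok (B⁺ s<m B , +-closed _ _ B∈W (matrix∈W (t s<m B)) , λ D⁺≈0 → Dₛ≉0 (begin
            D F ω m (mixed s B)                              ≈⟨ +-identityˡ _ ⟨
            0# + D F ω m (mixed s B)                         ≈⟨ +-congʳ Dₛ₊₁≈0 ⟨
            D F ω m (mixed (suc s) B) + D F ω m (mixed s B)  ≈⟨ D-mixed-step s<m B ⟨
            D F ω m (mixed (suc s) (B⁺ s<m B))               ≈⟨ D⁺≈0 ⟩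
            0#                                               ∎)) } }

    ¬¬-minor : ¬ ¬ (Σ[ B ∈ Mat F n ] W B × HasMinor F ω B m)
    ¬¬-minor = ¬¬-map (λ { (B , B∈W , D≉0) → B , B∈W , row , col , row-increasing , col-increasing ,
                            λ D≈0 → D≉0 (trans (D-cong ω m (λ α β → reflexive (mixed-below B α β (toℕ<n α)))) D≈0) })
                      (¬¬-mixed≉0 m ℕ.≤-refl)

  matching⇒staircase : ∀ {n m} {W : Mat F n → Set (c ⊔ ℓ)} {p : Fin m → Fin n × Fin n} →
                       IsMatching (𝔹 F W) m p → Staircase W m
  matching⇒staircase {n} {m} {W} {p} (p∈𝔹 , p-distinct)
    with sort (proj₁ ∘ p) (distinct⇒injective (proj₁ ∘ p) (λ x y → proj₁ ∘ p-distinct x y))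
  ... | by-row , by-row-inj , rows-sorted
    with sort (proj₂ ∘ p ∘ by-row)
              (by-row-inj ∘ distinct⇒injective (proj₂ ∘ p) (λ x y → proj₂ ∘ p-distinct x y))
  ... | by-col , by-col-inj , cols-sorted = record
    { row            = row
    ; col            = matched-col ∘ by-col
    ; row-increasing = λ a b → rows-sorted
    ; col-increasing = λ a b → cols-sorted
    ; pivot          = flip unsort
    ; matrix         = matrix
    ; matrix∈W       = proj₁ ∘ proj₂ ∘ p∈𝔹 ∘ by-row
    ; leading        = λ α → ≡.subst (λ j → IsQ F (matrix α) (row α , j))
                               (≡.sym (≡.cong matched-col (inverseʳ unsort))) (proj₂ (proj₂ (p∈𝔹 (by-row α))))
    }
    where
    row matched-col : Fin m → Fin n
    row         = proj₁ ∘ p ∘ by-row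
    matched-col = proj₂ ∘ p ∘ by-row
    unsort : Permutation′ m
    unsort = injective⇒permutation by-col-inj
    matrix : Fin m → Mat F n
    matrix = proj₁ ∘ p∈𝔹 ∘ by-row

proposition2p2 : {c ℓ : Level} (F : Field c ℓ) (ω : Weight F) → NonvanishingWeight F ω →
                 (n : ℕ) (W : Mat F n → Set (c ⊔ ℓ)) → IsSubspace F W →
                 (r m : ℕ) → IsMaxRank F ω W r → IsMaxMatching (𝔹 F W) m → m ≤ r
proposition2p2 F ω ω≉0 n W W-sub r zero    _             _                  = z≤n
proposition2p2 F ω ω≉0 n W W-sub r (suc m) (_ , rank≤r) ((_ , matching) , _) =
  decidable-stable (suc m ≤? r) λ m≰r →
    StaircaseMinor.¬¬-minor F W-sub ω ω≉0 (matching⇒staircase F matching) λ { (B , B∈W , minor) →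
      ¬¬-rank F ω B λ { (r′ , B-rank) →
        m≰r (ℕ.≤-trans (minor⇒≤rank F ω B B-rank minor) (rank≤r B B∈W r′ B-rank)) } }
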